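{- If $G$ is a simple undirected graph on $n$ vertices, then $\operatorname{OTI}(G)\subseteq\left[\lceil 2\sqrt n-1\rceil,\ n\right]$.
   Context: An orientation $\vec G$ of $G$ replaces each edge $\{u,v\}$ by exactly one of $(u,v),(v,u)$. Zero forcing on a digraph: vertices are blue or white; a blue vertex $u$ with exactly one white out-neighbor $w$ may force $w$ ($u\to w$), turning it blue. A set $\mathcal F$ of forces is a set of forces of $B\subseteq V$ if, starting with exactly $B$ blue, the forces in $\mathcal F$ can be validly performed in some order after which no further force is possible. Put $\mathcal F^{[0]}=B$ and $\mathcal F^{[t+1]}=\mathcal F^{[t]}\cup\{w\notin\mathcal F^{[t]}:(u\to w)\in\mathcal F,\ u\in\mathcal F^{[t]},\ w$ the only out-neighbor of $u$ outside $\mathcal F^{[t]}\}$; $\operatorname{pt}(\Gamma;\mathcal F)$ is the least $t$ with $\mathcal F^{[t]}=V$ ($\infty$ if none); $\operatorname{pt}(\Gamma;B)=\min_{\mathcal F}\operatorname{pt}(\Gamma;\mathcal F)$; $\operatorname{th}(\Gamma)=\min_{B\subseteq V}(|B|+\operatorname{pt}(\Gamma;B))$. $\operatorname{OTI}(G)$ is the set of integers in $[m,M]$ where $m$, $M$ are the minimum and maximum of $\operatorname{th}(\vec G)$ over all orientations $\vec G$ of $G$. -}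

module Defs where

open import Data.Nat using (ℕ; zero; suc; _+_; _*_; _^_; _≤_; _<_)
open import Data.Fin using (Fin)
open import Data.Fin.Subset using (Subset; _∈_; _∉_; ∣_∣)
open import Data.Bool using (Bool; true; false; not)
open import Data.Product using (Σ; ∃; ∃-syntax; _×_; _,_)
open import Data.Sum using (_⊎_)
open import Data.List using (List; []; _∷_)
open import Data.List.Membership.Propositional using () renaming (_∈_ to _∈ₗ_)
open import Relation.Binary.PropositionalEquality using (_≡_)
open import Relation.Nullary using (¬_)

record SimpleGraph (n : ℕ) : Set where
  field
    Adj   : Fin n → Fin n → Bool
    sym   : ∀ u v → Adj u v ≡ Adj v u
    irrefl : ∀ v → Adj v v ≡ false
open SimpleGraph public

Digraph : ℕ → Set
Digraph n = Fin n → Fin n → Bool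

-- D is an orientation of G: every edge {u,v} is replaced by exactly one of (u,v),(v,u),
-- and there are no other arcs.
IsOrientation : ∀ {n} → SimpleGraph n → Digraph n → Set
IsOrientation G D =
  (∀ u v → Adj G u v ≡ true → D u v ≡ not (D v u)) ×
  (∀ u v → D u v ≡ true → Adj G u v ≡ true)

ForceSet : ℕ → Set
ForceSet n = Fin n → Fin n → Bool

-- u can force w when S is the set of blue vertices.
CanForce : ∀ {n} → Digraph n → Subset n → Fin n → Fin n → Set
CanForce D S u w =
  u ∈ S × w ∉ S × D u w ≡ true × (∀ x → D u x ≡ true → x ∉ S → x ≡ w)

Add : ∀ {n} → Subset n → Fin n → Subset n
Add S w = S Data.Fin.Subset.∪ Data.Fin.Subset.⁅ w ⁆

ValidRun : ∀ {n} → Digraph n → Subset n → List (Fin n × Fin n) → Set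
ValidRun D S [] = ¬ (∃[ u ] ∃[ w ] CanForce D S u w)
ValidRun D S ((u , w) ∷ L) = CanForce D S u w × ValidRun D (Add S w) L

IsForcesOf : ∀ {n} → Digraph n → Subset n → ForceSet n → Set
IsForcesOf {n} D B F = Σ (List (Fin n × Fin n)) λ L →
  ValidRun D B L ×
  (∀ u w → (u , w) ∈ₗ L → F u w ≡ true) ×
  (∀ u w → F u w ≡ true → (u , w) ∈ₗ L)

Round : ∀ {n} → Digraph n → Subset n → ForceSet n → ℕ → Fin n → Set
Round D B F zero v = v ∈ B
Round D B F (suc t) w = Round D B F t w ⊎
  (∃[ u ] Round D B F t u × F u w ≡ true × D u w ≡ true ×
          (∀ x → D u x ≡ true → ¬ Round D B F t x → x ≡ w))

PtIs : ∀ {n} → Digraph n → Subset n → ForceSet n → ℕ → Set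
PtIs D B F t = (∀ v → Round D B F t v) × (∀ s → s < t → ¬ (∀ v → Round D B F s v))

ThIs : ∀ {n} → Digraph n → ℕ → Set
ThIs D k =
  (∃[ B ] ∃[ F ] ∃[ t ] IsForcesOf D B F × PtIs D B F t × ∣ B ∣ + t ≡ k) ×
  (∀ B F t → IsForcesOf D B F → PtIs D B F t → k ≤ ∣ B ∣ + t)

MinThIs : ∀ {n} → SimpleGraph n → ℕ → Set
MinThIs G m = (∃[ D ] IsOrientation G D × ThIs D m) ×
  (∀ D t → IsOrientation G D → ThIs D t → m ≤ t)

MaxThIs : ∀ {n} → SimpleGraph n → ℕ → Set
MaxThIs G M = (∃[ D ] IsOrientation G D × ThIs D M) ×
  (∀ D t → IsOrientation G D → ThIs D t → t ≤ M)

InOTI : ∀ {n} → SimpleGraph n → ℕ → Set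
InOTI G k = ∃[ m ] ∃[ M ] MinThIs G m × MaxThIs G M × m ≤ k × k ≤ M

-- ⌈2√n − 1⌉ ≤ k for a natural number k, i.e. 2√n ≤ k + 1, i.e. 4n ≤ (k+1)².
CeilTwoSqrtMinusOneLe : ℕ → ℕ → Set
CeilTwoSqrtMinusOneLe n k = 4 * n ≤ (k + 1) ^ 2

module Submission where

-- Upper bound: in any digraph the whole vertex set is a blue set
-- that needs no forces at all, so th ≤ |V| = n; in particular the maximum M of
-- th over orientations, and hence every k ∈ OTI(G), is at most n.
-- Lower bound: fix B and a set of forces F of B with F^[t] = V.  In a run every
-- vertex forces at most once, so F is functional; following forces backwards,
-- each vertex v ∈ F^[t] has a root in B and a depth ≤ t along its forcing chain,
-- and (root, depth) determines v.  Hence n ≤ |B|·(t+1) ≤ ((|B|+t+1)/2)², i.e.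
-- 4n ≤ (th + 1)² for every digraph, so 4n ≤ (m+1)² ≤ (k+1)² for k ∈ OTI(G).

open import Defs
open import Data.Nat using (ℕ; _≤_)
open import Data.Product using (_×_)

open import Data.Nat using (zero; suc; _+_; _*_; _^_; z≤n; s≤s)
import Data.Nat.Properties as ℕ
open import Data.Nat.Solver using (module +-*-Solver)
open import Data.Fin using (Fin; toℕ; fromℕ<; combine) renaming (zero to fzero; suc to fsuc)
import Data.Fin.Properties as Fin
open import Data.Fin.Subset using (Subset; ⊤; ⁅_⁆; _∈_; _∉_; ∣_∣)
open import Data.Fin.Subset.Properties using (∈⊤; ∣⊤∣≡n; p⊆p∪q)
open import Data.Vec using (here; there; _∷_)
open import Data.Bool using (true; false)
open import Data.Product using (_,_)
open import Data.Sum using (inj₁; inj₂)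
open import Data.List using ([]; _∷_)
open import Data.List.Relation.Unary.Any using (here; there)
open import Data.List.Membership.Propositional using () renaming (_∈_ to _∈ₗ_)
open import Relation.Binary.PropositionalEquality
  using (_≡_; refl; trans; cong; subst; subst₂; module ≡-Reasoning)
  renaming (sym to ≡-sym)

rank : ∀ {n} (B : Subset n) {r : Fin n} → r ∈ B → Fin ∣ B ∣
rank (true ∷ B)  here      = fzero
rank (true ∷ B)  (there p) = fsuc (rank B p)
rank (false ∷ B) (there p) = rank B p

rank-injective : ∀ {n} (B : Subset n) {r r′ : Fin n} (p : r ∈ B) (q : r′ ∈ B) →
                 rank B p ≡ rank B q → r ≡ r′
rank-injective (true ∷ B)  here      here      _  = refl
rank-injective (true ∷ B)  here      (there q) ()
rank-injective (true ∷ B)  (there p) here      ()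
rank-injective (true ∷ B)  (there p) (there q) eq =
  cong fsuc (rank-injective B p q (Fin.suc-injective eq))
rank-injective (false ∷ B) (there p) (there q) eq = cong fsuc (rank-injective B p q eq)

Functional : ∀ {n} → ForceSet n → Set
Functional {n} F = ∀ (u w w′ : Fin n) → F u w ≡ true → F u w′ ≡ true → w ≡ w′

module Runs {n : ℕ} (D : Digraph n) where

  -- Every force performed in a run from S goes along an arc to a vertex
  -- that is white in S (the blue set only grows during the run).
  performed-force : ∀ (S : Subset n) L {u w} → ValidRun D S L → (u , w) ∈ₗ L →
                    w ∉ S × D u w ≡ true
  performed-force S (_ ∷ L) ((_ , w∉S , arc , _) , _) (here refl) = w∉S , arc
  performed-force S ((_ , b) ∷ L) (_ , run) (there m) =
    let (w∉S+b , arc) = performed-force (Add S b) L run m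
    in (λ w∈S → w∉S+b (p⊆p∪q ⁅ b ⁆ w∈S)) , arc

  -- A vertex performs at most one force in a run: once u has forced w, its
  -- only white out-neighbour was w, and it has none left afterwards.
  run-functional : ∀ (S : Subset n) L {u w w′} → ValidRun D S L →
                   (u , w) ∈ₗ L → (u , w′) ∈ₗ L → w ≡ w′
  run-functional S (_ ∷ L) _ (here refl) (here refl) = refl
  run-functional S ((_ , b) ∷ L) ((_ , _ , _ , unique) , run) (here refl) (there m′) =
    let (w′∉ , arc) = performed-force (Add S b) L run m′
    in ≡-sym (unique _ arc (λ w′∈S → w′∉ (p⊆p∪q ⁅ b ⁆ w′∈S)))
  run-functional S ((_ , b) ∷ L) ((_ , _ , _ , unique) , run) (there m) (here refl) =
    let (w∉ , arc) = performed-force (Add S b) L run m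
    in unique _ arc (λ w∈S → w∉ (p⊆p∪q ⁅ b ⁆ w∈S))
  run-functional S ((_ , b) ∷ L) (_ , run) (there m) (there m′) =
    run-functional (Add S b) L run m m′

  forces-functional : ∀ {B F} → IsForcesOf D B F → Functional F
  forces-functional {B} (L , run , _ , F⊆L) u w w′ Fuw Fuw′ =
    run-functional B L run (F⊆L u w Fuw) (F⊆L u w′ Fuw′)

-- Forcing chains for a functional set of forces F from B.  A proof that v lies
-- in F^[t] traces a chain of forces back to a root in B; its length is the depth.
module ForcingChains {n : ℕ} (D : Digraph n) (B : Subset n) (F : ForceSet n)
                     (F-functional : Functional F) where

  root : ∀ {t v} → Round D B F t v → Fin n
  root {zero}  {v} _              = v
  root {suc t} (inj₁ p)           = root p
  root {suc t} (inj₂ (_ , p , _)) = root p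

  root∈B : ∀ {t v} (p : Round D B F t v) → root p ∈ B
  root∈B {zero}  p                 = p
  root∈B {suc t} (inj₁ p)          = root∈B p
  root∈B {suc t} (inj₂ (_ , p , _)) = root∈B p

  depth : ∀ {t v} → Round D B F t v → ℕ
  depth {zero}  _                 = 0
  depth {suc t} (inj₁ p)          = depth p
  depth {suc t} (inj₂ (_ , p , _)) = suc (depth p)

  -- One round adds at most one force to a chain.
  depth≤round : ∀ {t v} (p : Round D B F t v) → depth p ≤ t
  depth≤round {zero}  _                 = z≤n
  depth≤round {suc t} (inj₁ p)          = ℕ.m≤n⇒m≤1+n (depth≤round p)
  depth≤round {suc t} (inj₂ (_ , p , _)) = s≤s (depth≤round p)

  -- Since each vertex forces at most once, a chain is determined by its root
  -- and its length: the vertex reached is the same.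
  chain-injective : ∀ {s s′ v v′} (p : Round D B F s v) (p′ : Round D B F s′ v′) →
                    root p ≡ root p′ → depth p ≡ depth p′ → v ≡ v′
  chain-injective {zero}  {zero}   p        p′                 r d = r
  chain-injective {zero}  {suc s′} p        (inj₁ p′)          r d = chain-injective p p′ r d
  chain-injective {zero}  {suc s′} p        (inj₂ _)           r ()
  chain-injective {suc s}          (inj₁ p) p′                 r d = chain-injective p p′ r d
  chain-injective {suc s} {zero}   (inj₂ _) p′                 r ()
  chain-injective {suc s} {suc s′} p@(inj₂ _) (inj₁ p′)        r d = chain-injective p p′ r d
  chain-injective {suc s} {suc s′} (inj₂ (u , p , Fuv , _)) (inj₂ (u′ , p′ , Fu′v′ , _)) r d
    with chain-injective p p′ r (ℕ.suc-injective d)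
  ... | refl = F-functional u _ _ Fuv Fu′v′

  -- If F^[t] = V then v ↦ (root, depth) injects V into B × {0,…,t}.
  cover-bound : ∀ t → (∀ v → Round D B F t v) → n ≤ ∣ B ∣ * suc t
  cover-bound t covered = Fin.injective⇒≤ {f = code} code-injective
    where
    depth-index : ∀ v → Fin (suc t)
    depth-index v = fromℕ< (s≤s (depth≤round (covered v)))

    code : Fin n → Fin (∣ B ∣ * suc t)
    code v = combine (rank B (root∈B (covered v))) (depth-index v)

    same-depth : ∀ {x y} → depth-index x ≡ depth-index y →
                 depth (covered x) ≡ depth (covered y)
    same-depth {x} {y} eq = begin
      depth (covered x)  ≡⟨ Fin.toℕ-fromℕ< _ ⟨
      toℕ (depth-index x) ≡⟨ cong toℕ eq ⟩
      toℕ (depth-index y) ≡⟨ Fin.toℕ-fromℕ< _ ⟩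
      depth (covered y)  ∎
      where open ≡-Reasoning

    code-injective : ∀ {x y} → code x ≡ code y → x ≡ y
    code-injective {x} {y} eq =
      let (same-rank , same-index) = Fin.combine-injective _ _ _ _ eq
      in chain-injective (covered x) (covered y)
           (rank-injective B _ _ same-rank) (same-depth same-index)

square-expansion : ∀ a c → 4 * (a * (a + c)) + c * c ≡ (a + (a + c)) ^ 2
square-expansion = solve 2 (λ a c → con 4 :* (a :* (a :+ c)) :+ c :* c
                                    := (a :+ (a :+ c)) :^ 2) refl
  where open +-*-Solver

-- AM–GM for a pair a ≤ a + c; the square of the difference c is dropped.
am-gm-ordered : ∀ a c → 4 * (a * (a + c)) ≤ (a + (a + c)) ^ 2
am-gm-ordered a c = ℕ.≤-trans (ℕ.m≤m+n _ (c * c)) (ℕ.≤-reflexive (square-expansion a c))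

am-gm : ∀ a b → 4 * (a * b) ≤ (a + b) ^ 2
am-gm a b with ℕ.≤-total a b
... | inj₁ a≤b = let (c , a+c≡b) = ℕ.m≤n⇒∃[o]m+o≡n a≤b in
  subst₂ (λ x y → 4 * (a * x) ≤ (a + y) ^ 2) a+c≡b a+c≡b (am-gm-ordered a c)
... | inj₂ b≤a = let (c , b+c≡a) = ℕ.m≤n⇒∃[o]m+o≡n b≤a in
  subst₂ (λ x y → 4 * x ≤ y ^ 2)
         (trans (ℕ.*-comm b (b + c)) (cong (_* b) b+c≡a))
         (trans (ℕ.+-comm b (b + c)) (cong (_+ b) b+c≡a))
         (am-gm-ordered b c)

cover-lower-bound : ∀ {n} (D : Digraph n) {B F} t → IsForcesOf D B F →
                    (∀ v → Round D B F t v) → 4 * n ≤ (∣ B ∣ + t + 1) ^ 2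
cover-lower-bound {n} D {B} {F} t forces covered = begin
  4 * n                       ≤⟨ ℕ.*-monoʳ-≤ 4 (ForcingChains.cover-bound D B F
                                   (Runs.forces-functional D forces) t covered) ⟩
  4 * (∣ B ∣ * suc t)          ≤⟨ am-gm ∣ B ∣ (suc t) ⟩
  (∣ B ∣ + suc t) ^ 2          ≡⟨ cong (_^ 2) (ℕ.+-suc ∣ B ∣ t) ⟩
  (1 + (∣ B ∣ + t)) ^ 2        ≡⟨ cong (_^ 2) (ℕ.+-comm 1 (∣ B ∣ + t)) ⟩
  (∣ B ∣ + t + 1) ^ 2          ∎
  where open ℕ.≤-Reasoning

th-lower-bound : ∀ {n} (D : Digraph n) {m} → ThIs D m → 4 * n ≤ (m + 1) ^ 2
th-lower-bound {n} D ((B , F , t , forces , (covered , _) , |B|+t≡m) , _) =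
  subst (λ m → 4 * n ≤ (m + 1) ^ 2) |B|+t≡m (cover-lower-bound D t forces covered)

th-upper-bound : ∀ {n} (D : Digraph n) {k} → ThIs D k → k ≤ n
th-upper-bound {n} D {k} (_ , minimal) = begin
  k              ≤⟨ minimal ⊤ no-forces 0 all-blue-forces all-blue-pt ⟩
  ∣ ⊤ {n} ∣ + 0  ≡⟨ ℕ.+-identityʳ _ ⟩
  ∣ ⊤ {n} ∣      ≡⟨ ∣⊤∣≡n n ⟩
  n              ∎
  where
  open ℕ.≤-Reasoning

  no-forces : ForceSet n
  no-forces _ _ = false

  all-blue-forces : IsForcesOf D ⊤ no-forces
  all-blue-forces = [] , (λ (_ , w , _ , w∉⊤ , _) → w∉⊤ ∈⊤) , (λ _ _ ()) , (λ _ _ ())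

  all-blue-pt : PtIs D ⊤ no-forces 0
  all-blue-pt = (λ _ → ∈⊤) , (λ _ ())

proposition3p6 : (n : ℕ) (G : SimpleGraph n) (k : ℕ) → InOTI G k →
    CeilTwoSqrtMinusOneLe n k × k ≤ n
proposition3p6 n G k (m , M , ((D , _ , th-D≡m) , _) , ((D′ , _ , th-D′≡M) , _) , m≤k , k≤M) =
  lower , upper
  where
  lower : 4 * n ≤ (k + 1) ^ 2
  lower = ℕ.≤-trans (th-lower-bound D th-D≡m) (ℕ.^-monoˡ-≤ 2 (ℕ.+-monoˡ-≤ 1 m≤k))

  upper : k ≤ n
  upper = ℕ.≤-trans k≤M (th-upper-bound D′ th-D′≡M)
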